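{- Let $H$ be a graph with at least one edge and no isolated edges, and suppose $k_1' > k_0$. Then for every $n \geq |H|$, \[ \operatorname{sat}(n,H) \geq \left( k_0 + \frac{k_1' - k_0}{k_1' + 1} \right) \frac{n}{2} - c_1. \] If, in addition, $k_1 > k_0$, then \[ \operatorname{sat}(n,H) \geq \left( k_0 + \frac{k_1' - k_0}{k_1'} \right) \frac{n}{2} - c_2, \] where $c_1 = \frac{(k_0 + 1)(k_1' - k_0)}{2k_1' + 2} + \frac{(k_0 + 1)^2}{8}$ and $c_2 = \frac{(k_0 + 2)(k_1' - k_0)}{2k_1'} + \frac{(k_0 + 1)^2}{8}$.
   Context: Graphs are finite and simple; $|G|$ denotes the number of vertices. A graph $G$ is $H$-saturated if $G$ contains no subgraph isomorphic to $H$ but adding any edge joining two nonadjacent vertices of $G$ creates such a subgraph. $\operatorname{sat}(n,H)$ is the minimum number of edges of an $H$-saturated graph on $n$ vertices. For an edge $uv$ of $H$, let $N(uv) = (N(u)\setminus\{v\}) \cup (N(v)\setminus\{u\})$; the edge is isolated if $N(uv)=\varnothing$. Degrees are taken in $H$. Define $\mathrm{wt}_0(uv) = \max\{d(u),d(v)\} - 1$ and, for non-isolated $uv$, $\mathrm{wt}_1(uv) = \max_{w \in N(uv)} d(w)$. Let $k_0 = \min_{uv\in E(H)} \mathrm{wt}_0(uv)$, $k_1 = \min_{uv \in E(H)} \mathrm{wt}_1(uv)$, and $k_1' = \min\{\mathrm{wt}_1(uv) : uv \in E(H),\ \mathrm{wt}_0(uv) = k_0\}$. -}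

module Defs where

open import Data.Nat using (ℕ; zero; suc; _<_; _∸_; _+_; _*_)
open import Data.Nat as ℕ using ()
open import Data.Bool using (Bool; true; false; _∨_; _∧_; not; if_then_else_)
open import Data.Fin using (Fin; toℕ; _≟_)
open import Data.List using (List; allFin; filter; length; concatMap; map)
open import Data.Product using (Σ; ∃; ∃-syntax; _×_; _,_)
open import Relation.Binary.PropositionalEquality using (_≡_; _≢_)
open import Relation.Nullary using (¬_; does)
open import Relation.Nullary.Decidable.Core using (T?)
open import Function.Definitions using (Injective)
open import Data.Integer using (+_)
open import Data.Rational using (ℚ; _/_)

record Graph (n : ℕ) : Set where
  field
    adj    : Fin n → Fin n → Bool
    sym    : ∀ u v → adj u v ≡ adj v u
    irrefl : ∀ u → adj u u ≡ false
open Graph public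

∣_∣ᵥ : ∀ {n} → Graph n → ℕ
∣_∣ᵥ {n} _ = n

Edge : ∀ {n} → Graph n → Fin n → Fin n → Set
Edge G u v = adj G u v ≡ true

numEdges : ∀ {n} → Graph n → ℕ
numEdges {n} G =
  length (filter (λ p → toℕ (Data.Product.proj₁ p) ℕ.<? toℕ (Data.Product.proj₂ p))
    (filter (λ p → T? (adj G (Data.Product.proj₁ p) (Data.Product.proj₂ p)))
      (concatMap (λ u → map (λ v → (u , v)) (allFin n)) (allFin n))))

deg : ∀ {n} → Graph n → Fin n → ℕ
deg {n} G v = length (filter (λ w → T? (adj G v w)) (allFin n))

ContainsCopy : ∀ {n h} → Graph n → Graph h → Set
ContainsCopy {n} {h} G H =
  Σ (Fin h → Fin n) λ f → Injective _≡_ _≡_ f × (∀ u v → Edge H u v → Edge G (f u) (f v))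

addEdge : ∀ {n} → Graph n → (x y : Fin n) → x ≢ y → Graph n
addEdge {n} G x y x≢y = record { adj = a ; sym = s ; irrefl = i }
  where
  isxy : Fin n → Fin n → Bool
  isxy u v = (does (u ≟ x) ∧ does (v ≟ y)) ∨ (does (u ≟ y) ∧ does (v ≟ x))
  a : Fin n → Fin n → Bool
  a u v = adj G u v ∨ isxy u v
  open import Data.Bool.Properties using (∨-comm; ∧-comm)
  open import Relation.Binary.PropositionalEquality using (cong₂; refl)
  open import Relation.Nullary using (yes; no)
  s : ∀ u v → a u v ≡ a v u
  s u v rewrite Graph.sym G u v | ∨-comm (does (u ≟ x) ∧ does (v ≟ y)) (does (u ≟ y) ∧ does (v ≟ x))
    | ∧-comm (does (u ≟ x)) (does (v ≟ y)) | ∧-comm (does (u ≟ y)) (does (v ≟ x)) = refl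
  i : ∀ u → a u u ≡ false
  i u rewrite Graph.irrefl G u with u ≟ x | u ≟ y
  ... | no _ | no _ = refl
  ... | yes _ | no _ = refl
  ... | no _ | yes _ = refl
  ... | yes refl | yes refl = Data.Empty.⊥-elim (x≢y refl)
    where import Data.Empty

Saturated : ∀ {n h} → Graph h → Graph n → Set
Saturated {n} H G =
  ¬ ContainsCopy G H ×
  (∀ x y (x≢y : x ≢ y) → adj G x y ≡ false → ContainsCopy (addEdge G x y x≢y) H)

InN : ∀ {h} → Graph h → Fin h → Fin h → Fin h → Set
InN H u v w = w ≢ u × w ≢ v × (Edge H u w Data.Sum.⊎ Edge H v w)
  where import Data.Sum

IsolatedEdge : ∀ {h} → Graph h → Fin h → Fin h → Set
IsolatedEdge H u v = Edge H u v × (∀ w → ¬ InN H u v w)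

wt₀ : ∀ {h} → Graph h → Fin h → Fin h → ℕ
wt₀ H u v = ℕ._⊔_ (deg H u) (deg H v) ∸ 1

Wt₁ : ∀ {h} → Graph h → Fin h → Fin h → ℕ → Set
Wt₁ H u v k = (∃[ w ] (InN H u v w × deg H w ≡ k)) × (∀ w → InN H u v w → deg H w ℕ.≤ k)

IsK₀ : ∀ {h} → Graph h → ℕ → Set
IsK₀ H k = (∃[ u ] ∃[ v ] (Edge H u v × wt₀ H u v ≡ k)) ×
           (∀ u v → Edge H u v → k ℕ.≤ wt₀ H u v)

IsK₁ : ∀ {h} → Graph h → ℕ → Set
IsK₁ H k = (∃[ u ] ∃[ v ] (Edge H u v × Wt₁ H u v k)) ×
           (∀ u v j → Edge H u v → Wt₁ H u v j → k ℕ.≤ j)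

IsK₁' : ∀ {h} → Graph h → ℕ → ℕ → Set
IsK₁' H k₀ k = (∃[ u ] ∃[ v ] (Edge H u v × wt₀ H u v ≡ k₀ × Wt₁ H u v k)) ×
               (∀ u v j → Edge H u v → wt₀ H u v ≡ k₀ → Wt₁ H u v j → k ℕ.≤ j)

-- a / d as a rational (d > 0 in all uses; d = 0 gives 0 by convention)
_÷ℕ_ : ℕ → ℕ → ℚ
a ÷ℕ zero  = + 0 / 1
a ÷ℕ suc d = + a / suc d

ℕ→ℚ : ℕ → ℚ
ℕ→ℚ a = + a / 1

¬IsolatedEdge : ∀ {h} → Graph h → Fin h → Fin h → Set
¬IsolatedEdge H u v = ¬ IsolatedEdge H u v

{-# OPTIONS --safe #-}
module Submission where

-- Write d for degrees in the H-saturated graph G, e for its number of edges and A = k₁' − k₀.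
-- For non-adjacent x, y, a copy of H in G + xy maps some edge uv of H onto xy; then
-- d_H(u) ≤ d(x) + 1, d_H(v) ≤ d(y) + 1, and every w ∈ N(uv) lands on a neighbour of x or y of
-- degree ≥ d_H(w).  Hence the vertices of degree < k₀ form a clique S, the vertices of degree ≤ k₀
-- without neighbours of degree ≥ k₁' form a clique L, and if k₁ > k₀, at most one vertex of
-- degree ≥ k₁' has only neighbours of degree ≤ k₀.
-- Give every vertex the charge K·d(v) and let each vertex of degree ≥ k₁' send A to each of its
-- neighbours of degree ≤ k₀.  Afterwards each vertex v holds at least k₀K + A − K(k₀ ∸ d(v)),
-- except that the vertices of L, and for K = k₁' the exceptional vertex, may lack a further A.
-- Summing, n(k₀K + A) ≤ 2Ke + K·Σ(k₀ ∸ d) + A(|L| + …), where Σ(k₀ ∸ d) ≤ |S|(k₀ + 1 − |S|)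
-- ≤ (k₀ + 1)²/4 and |L| ≤ k₀ + 1.  Take K = k₁' + 1, resp. K = k₁'.

open import Defs hiding (sym)
open import Data.Nat as ℕ using (ℕ; zero; suc; _+_; _*_; _∸_; _^_; _<_; _≤_; z≤n; s≤s; _⊔_)
open import Data.Fin using (Fin; zero; suc; toℕ; _≟_)
open import Data.Product using (_×_; ∃-syntax; _,_; proj₁; proj₂)
open import Data.Rational using (toℚᵘ) renaming (_+_ to _+ℚ_; _*_ to _*ℚ_; _-_ to _-ℚ_; _≤_ to _≤ℚ_)

open import Data.Bool using (Bool; true; false; T; _∧_; _∨_; if_then_else_)
import Data.Bool as Bool
import Data.Fin.Properties as Finₚ
open import Data.Integer as ℤ using (_⊖_)
import Data.Integer.Properties as ℤ
open import Data.List as List using (List; []; _∷_; filter; length; allFin; tabulate; concatMap)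
open import Data.List.Extrema.Nat using (argmax; argmax-all; f[xs]≤f[argmax])
open import Data.List.Membership.Propositional.Properties using (∈-filter⁺; ∈-allFin)
open import Data.List.Properties using (map-tabulate; map-++)
import Data.List.Relation.Unary.All as All
open import Data.List.Relation.Unary.All.Properties using (all-filter)
open import Data.Nat.ListAction using () renaming (sum to sumˡ)
open import Data.Nat.ListAction.Properties using (sum-++)
open import Data.Nat.Properties hiding (_≟_)
open import Data.Nat.Tactic.RingSolver using (solve; solve-∀)
open import Data.Rational.Properties
  using (toℚᵘ-fromℚᵘ; toℚᵘ-cancel-≤; toℚᵘ-homo-+; toℚᵘ-homo-*; toℚᵘ-homo‿-)
open import Data.Rational.Unnormalised as ℚᵘ using (mkℚᵘ; ↥_; *≤*)
  renaming (_+_ to _+ᵘ_; _*_ to _*ᵘ_; _-_ to _-ᵘ_; _/_ to _/ᵘ_; _≤_ to _≤ᵘ_; _≃_ to _≃ᵘ_)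
import Data.Rational.Unnormalised.Properties as ℚᵘ
open import Data.Sum using (_⊎_; inj₁; inj₂; [_,_]′)
open import Data.Vec.Functional using (updateAt)
open import Data.Vec.Functional.Properties using (updateAt-minimal)
open import Function using (_∘_; const)
open import Function.Definitions using (Injective)
open import Relation.Binary.Definitions using (tri<; tri≈; tri>)
open import Relation.Binary.PropositionalEquality
open import Relation.Nullary using (¬_; Dec; yes; no; does; contradiction)
open import Relation.Nullary.Decidable using (dec-true; dec-false)
open import Relation.Nullary.Decidable.Core using (T?; _→-dec_; _×-dec_; _⊎-dec_; ¬?)
open import Relation.Unary using (Pred; Decidable)

open import Algebra.Properties.Semiring.Sum +-*-semiring
  using (sum; sum-syntax; sum-cong-≗; ∑-distrib-+; ∑-comm; *-distribˡ-sum; *-distribʳ-sum; sum-replicate-zero)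

private
  variable
    m n h : ℕ
    G : Graph n
    H : Graph h

𝟙 : Bool → ℕ
𝟙 true  = 1
𝟙 false = 0

𝟙-mono : ∀ {a b} → (a ≡ true → b ≡ true) → 𝟙 a ≤ 𝟙 b
𝟙-mono {false} a⇒b = z≤n
𝟙-mono {true}  a⇒b rewrite a⇒b refl = ≤-refl

𝟙-∧ : ∀ a b → 𝟙 (a ∧ b) ≡ 𝟙 a * 𝟙 b
𝟙-∧ false b = refl
𝟙-∧ true  b = sym (+-identityʳ (𝟙 b))

𝟙-∨ : ∀ a b → 𝟙 (a ∨ b) ≤ 𝟙 a + 𝟙 b
𝟙-∨ false b = ≤-refl
𝟙-∨ true  b = s≤s z≤n

𝟙*𝟙≤𝟙 : ∀ a b → 𝟙 a * 𝟙 b ≤ 𝟙 a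
𝟙*𝟙≤𝟙 false b     = z≤n
𝟙*𝟙≤𝟙 true  true  = ≤-refl
𝟙*𝟙≤𝟙 true  false = z≤n

𝟙-does≡1 : ∀ {p} {P : Set p} (P? : Dec P) → 𝟙 (does P?) ≡ 1 → P
𝟙-does≡1 (yes p) _ = p

if≡𝟙* : ∀ b x → (if b then x else 0) ≡ 𝟙 b * x
if≡𝟙* true  x = sym (+-identityʳ x)
if≡𝟙* false x = refl

δ : Fin n → Fin n → ℕ
δ i j = 𝟙 (does (i ≟ j))

δ-refl : (i : Fin n) → δ i i ≡ 1
δ-refl i = cong 𝟙 (dec-true (i ≟ i) refl)

δ-≢ : {i j : Fin n} → i ≢ j → δ i j ≡ 0
δ-≢ {i = i} {j} i≢j = cong 𝟙 (dec-false (i ≟ j) i≢j)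

sum-const : (c : ℕ) → ∑[ i < n ] c ≡ n * c
sum-const {zero}  c = refl
sum-const {suc n} c = cong (c +_) (sum-const {n} c)

sum-mono-≤ : {f g : Fin n → ℕ} → (∀ i → f i ≤ g i) → sum f ≤ sum g
sum-mono-≤ {zero}  f≤g = z≤n
sum-mono-≤ {suc n} f≤g = +-mono-≤ (f≤g zero) (sum-mono-≤ (f≤g ∘ suc))

sum-≡⇒≗ : {f g : Fin n → ℕ} → (∀ i → f i ≤ g i) → sum f ≡ sum g → ∀ i → f i ≡ g i
sum-≡⇒≗ {suc n} {f} {g} f≤g Σf≡Σg = λ where
    zero    → f₀≡g₀
    (suc i) → sum-≡⇒≗ (f≤g ∘ suc) (+-cancelˡ-≡ (f zero) _ _ (trans Σf≡Σg (cong (_+ _) (sym f₀≡g₀)))) i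
  where
  f₀≡g₀ : f zero ≡ g zero
  f₀≡g₀ = ≤-antisym (f≤g zero) (+-cancelʳ-≤ _ _ _ (begin
    g zero + sum (f ∘ suc) ≤⟨ +-monoʳ-≤ (g zero) (sum-mono-≤ (f≤g ∘ suc)) ⟩
    g zero + sum (g ∘ suc) ≡⟨ sym Σf≡Σg ⟩
    f zero + sum (f ∘ suc) ∎))
    where open ≤-Reasoning

term≤sum : (f : Fin n → ℕ) (i : Fin n) → f i ≤ sum f
term≤sum f zero    = m≤m+n (f zero) _
term≤sum f (suc i) = ≤-trans (term≤sum (f ∘ suc) i) (m≤n+m _ (f zero))

sum-δ : (i : Fin n) → ∑[ j < n ] δ j i ≡ 1
sum-δ {suc n} zero    = cong suc (sum-replicate-zero n)
sum-δ {suc n} (suc i) = sum-δ i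

sum-scaled-δ : (c : ℕ) (i : Fin n) → ∑[ j < n ] (c * δ j i) ≡ c
sum-scaled-δ {n} c i = begin
  ∑[ j < n ] (c * δ j i) ≡⟨ *-distribˡ-sum c (λ j → δ j i) ⟨
  c * ∑[ j < n ] δ j i   ≡⟨ cong (c *_) (sum-δ i) ⟩
  c * 1                  ≡⟨ *-identityʳ c ⟩
  c                      ∎
  where open ≡-Reasoning

sum-updateAt : (g : Fin n → ℕ) (i : Fin n) → sum g ≡ g i + sum (updateAt g i (const 0))
sum-updateAt g zero    = refl
sum-updateAt g (suc i) = begin
  g zero + sum (g ∘ suc)                                      ≡⟨ cong (g zero +_) (sum-updateAt (g ∘ suc) i) ⟩
  g zero + (g (suc i) + sum (updateAt (g ∘ suc) i (const 0))) ≡⟨ swap-front (g zero) (g (suc i)) _ ⟩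
  g (suc i) + (g zero + sum (updateAt (g ∘ suc) i (const 0))) ∎
  where
  open ≡-Reasoning
  swap-front : ∀ a b c → a + (b + c) ≡ b + (a + c)
  swap-front = solve-∀

sum-∘-injective : (f : Fin m → Fin n) → Injective _≡_ _≡_ f → (g : Fin n → ℕ) → sum (g ∘ f) ≤ sum g
sum-∘-injective {zero}  f f-inj g = z≤n
sum-∘-injective {suc m} f f-inj g = begin
  g (f zero) + sum (g ∘ f ∘ suc)  ≡⟨ cong (g (f zero) +_) (sum-cong-≗ g≗g′) ⟩
  g (f zero) + sum (g′ ∘ f ∘ suc) ≤⟨ +-monoʳ-≤ _ (sum-∘-injective (f ∘ suc) (Finₚ.suc-injective ∘ f-inj) g′) ⟩
  g (f zero) + sum g′             ≡⟨ sum-updateAt g (f zero) ⟨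
  sum g                           ∎
  where
  open ≤-Reasoning
  g′ = updateAt g (f zero) (const 0)
  g≗g′ : ∀ i → g (f (suc i)) ≡ g′ (f (suc i))
  g≗g′ i = sym (updateAt-minimal (f (suc i)) (f zero) g (Finₚ.0≢1+n ∘ sym ∘ f-inj))

count : ∀ {p} {C : Pred (Fin n) p} → Decidable C → ℕ
count {n} C? = ∑[ v < n ] 𝟙 (does (C? v))

sum-if : ∀ {p} {C : Pred (Fin n) p} (C? : Decidable C) (c : ℕ) →
  ∑[ v < n ] (if does (C? v) then c else 0) ≡ count C? * c
sum-if {n} C? c = trans (sum-cong-≗ (λ v → if≡𝟙* (does (C? v)) c)) (sym (*-distribʳ-sum c (λ v → 𝟙 (does (C? v)))))

module _ {a p} {A : Set a} {P : Pred A p} (P? : Decidable P) where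

  length-filter≡sum : (xs : List A) → length (filter P? xs) ≡ sumˡ (List.map (𝟙 ∘ does ∘ P?) xs)
  length-filter≡sum []       = refl
  length-filter≡sum (x ∷ xs) with does (P? x)
  ... | true  = cong suc (length-filter≡sum xs)
  ... | false = length-filter≡sum xs

  sum-map-filter : (g : A → ℕ) (xs : List A) →
    sumˡ (List.map g (filter P? xs)) ≡ sumˡ (List.map (λ x → 𝟙 (does (P? x)) * g x) xs)
  sum-map-filter g []       = refl
  sum-map-filter g (x ∷ xs) with does (P? x)
  ... | true  = cong₂ _+_ (sym (+-identityʳ (g x))) (sum-map-filter g xs)
  ... | false = sum-map-filter g xs

sum-map-concatMap : ∀ {a b} {A : Set a} {B : Set b} (g : B → ℕ) (k : A → List B) (xs : List A) →
  sumˡ (List.map g (concatMap k xs)) ≡ sumˡ (List.map (sumˡ ∘ List.map g ∘ k) xs)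
sum-map-concatMap g k []       = refl
sum-map-concatMap g k (x ∷ xs) = begin
  sumˡ (List.map g (k x List.++ concatMap k xs))              ≡⟨ cong sumˡ (map-++ g (k x) _) ⟩
  sumˡ (List.map g (k x) List.++ List.map g (concatMap k xs)) ≡⟨ sum-++ (List.map g (k x)) _ ⟩
  sumˡ (List.map g (k x)) + sumˡ (List.map g (concatMap k xs))
    ≡⟨ cong (sumˡ (List.map g (k x)) +_) (sum-map-concatMap g k xs) ⟩
  sumˡ (List.map g (k x)) + sumˡ (List.map (sumˡ ∘ List.map g ∘ k) xs) ∎
  where open ≡-Reasoning

sum-map-tabulate : ∀ {a} {A : Set a} (g : A → ℕ) (f : Fin n → A) →
  sumˡ (List.map g (tabulate f)) ≡ ∑[ i < n ] g (f i)
sum-map-tabulate {zero}  g f = refl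
sum-map-tabulate {suc n} g f = cong (g (f zero) +_) (sum-map-tabulate g (f ∘ suc))

sum-map-pairs : (g : Fin n × Fin n → ℕ) →
  sumˡ (List.map g (concatMap (λ u → List.map (λ v → (u , v)) (allFin n)) (allFin n)))
    ≡ ∑[ u < n ] ∑[ v < n ] g (u , v)
sum-map-pairs {n} g = begin
  sumˡ (List.map g (concatMap row (allFin n)))          ≡⟨ sum-map-concatMap g row (allFin n) ⟩
  sumˡ (List.map (sumˡ ∘ List.map g ∘ row) (allFin n)) ≡⟨ sum-map-tabulate {n} _ (λ u → u) ⟩
  ∑[ u < n ] sumˡ (List.map g (row u))                 ≡⟨ sum-cong-≗ row-sum ⟩
  ∑[ u < n ] ∑[ v < n ] g (u , v)                      ∎
  where
  open ≡-Reasoning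
  row : Fin n → List (Fin n × Fin n)
  row u = List.map (λ v → (u , v)) (allFin n)
  row-sum : ∀ u → sumˡ (List.map g (row u)) ≡ ∑[ v < n ] g (u , v)
  row-sum u = trans (cong (sumˡ ∘ List.map g) (map-tabulate (λ v → v) (u ,_))) (sum-map-tabulate g (u ,_))

deg≡∑ : (G : Graph n) (v : Fin n) → deg G v ≡ ∑[ w < n ] 𝟙 (adj G v w)
deg≡∑ {n} G v = trans (length-filter≡sum (λ w → T? (adj G v w)) (allFin n)) (sum-map-tabulate {n} _ (λ w → w))

forward : (G : Graph n) → Fin n → Fin n → ℕ
forward G u v = 𝟙 (adj G u v) * 𝟙 (does (toℕ u <? toℕ v))

numEdges≡∑ : (G : Graph n) → numEdges G ≡ ∑[ u < n ] ∑[ v < n ] forward G u v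
numEdges≡∑ {n} G = begin
  numEdges G                                                          ≡⟨ length-filter≡sum lt? (filter adj? pairs) ⟩
  sumˡ (List.map (𝟙 ∘ does ∘ lt?) (filter adj? pairs))                ≡⟨ sum-map-filter adj? _ pairs ⟩
  sumˡ (List.map (λ p → 𝟙 (does (adj? p)) * 𝟙 (does (lt? p))) pairs) ≡⟨ sum-map-pairs {n} _ ⟩
  ∑[ u < n ] ∑[ v < n ] forward G u v                                 ∎
  where
  open ≡-Reasoning
  pairs = concatMap (λ u → List.map (λ v → (u , v)) (allFin n)) (allFin n)
  adj? : (p : Fin n × Fin n) → Dec (T (adj G (proj₁ p) (proj₂ p)))
  adj? p = T? (adj G (proj₁ p) (proj₂ p))
  lt? : (p : Fin n × Fin n) → Dec (toℕ (proj₁ p) < toℕ (proj₂ p))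
  lt? p = toℕ (proj₁ p) <? toℕ (proj₂ p)

forward-< : (G : Graph n) {u v : Fin n} → toℕ u < toℕ v → forward G u v ≡ 𝟙 (adj G u v)
forward-< G {u} {v} u<v =
  trans (cong (λ b → 𝟙 (adj G u v) * 𝟙 b) (dec-true (toℕ u <? toℕ v) u<v)) (*-identityʳ _)

forward-≮ : (G : Graph n) {u v : Fin n} → ¬ toℕ u < toℕ v → forward G u v ≡ 0
forward-≮ G {u} {v} u≮v =
  trans (cong (λ b → 𝟙 (adj G u v) * 𝟙 b) (dec-false (toℕ u <? toℕ v) u≮v)) (*-zeroʳ (𝟙 (adj G u v)))

adj≡forward+backward : (G : Graph n) (u v : Fin n) → 𝟙 (adj G u v) ≡ forward G u v + forward G v u
adj≡forward+backward G u v with <-cmp (toℕ u) (toℕ v)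
... | tri< u<v _ v≮u = sym (trans (cong₂ _+_ (forward-< G u<v) (forward-≮ G v≮u)) (+-identityʳ _))
... | tri> u≮v _ v<u = sym (trans (cong₂ _+_ (forward-≮ G u≮v) (forward-< G v<u)) (cong 𝟙 (Graph.sym G v u)))
... | tri≈ u≮v u≡v _ with refl ← Finₚ.toℕ-injective u≡v =
  trans (cong 𝟙 (irrefl G u)) (sym (cong₂ _+_ (forward-≮ G u≮v) (forward-≮ G u≮v)))

handshake : (G : Graph n) → ∑[ v < n ] deg G v ≡ 2 * numEdges G
handshake {n} G = begin
  ∑[ u < n ] deg G u                                              ≡⟨ sum-cong-≗ (deg≡∑ G) ⟩
  ∑[ u < n ] ∑[ v < n ] 𝟙 (adj G u v)                             ≡⟨ sum-cong-≗ (sum-cong-≗ ∘ adj≡forward+backward G) ⟩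
  ∑[ u < n ] ∑[ v < n ] (forward G u v + forward G v u)           ≡⟨ sum-cong-≗ (λ u → ∑-distrib-+ (forward G u) _) ⟩
  ∑[ u < n ] (∑[ v < n ] forward G u v + ∑[ v < n ] forward G v u) ≡⟨ ∑-distrib-+ {n} _ _ ⟩
  E + ∑[ u < n ] ∑[ v < n ] forward G v u                         ≡⟨ cong (E +_) (∑-comm (λ u v → forward G v u)) ⟩
  E + E                                                           ≡⟨ cong (E +_) (+-identityʳ E) ⟨
  2 * E                                                           ≡⟨ cong (2 *_) (numEdges≡∑ G) ⟨
  2 * numEdges G                                                  ∎
  where
  open ≡-Reasoning
  E = ∑[ u < n ] ∑[ v < n ] forward G u v

adj-addEdge : (G : Graph n) (x y : Fin n) (x≢y : x ≢ y) (u v : Fin n) →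
  𝟙 (adj (addEdge G x y x≢y) u v) ≤ 𝟙 (adj G u v) + (δ u x * δ v y + δ u y * δ v x)
adj-addEdge G x y x≢y u v =
  ≤-trans (𝟙-∨ (adj G u v) (u≡x∧v≡y ∨ u≡y∧v≡x))
    (+-monoʳ-≤ _ (≤-trans (𝟙-∨ u≡x∧v≡y u≡y∧v≡x)
      (≤-reflexive (cong₂ _+_ (𝟙-∧ (does (u ≟ x)) (does (v ≟ y))) (𝟙-∧ (does (u ≟ y)) (does (v ≟ x)))))))
  where
  u≡x∧v≡y = does (u ≟ x) ∧ does (v ≟ y)
  u≡y∧v≡x = does (u ≟ y) ∧ does (v ≟ x)

deg-addEdge : (G : Graph n) (x y : Fin n) (x≢y : x ≢ y) (v : Fin n) →
  deg (addEdge G x y x≢y) v ≤ deg G v + (δ v x + δ v y)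
deg-addEdge {n} G x y x≢y v = begin
  deg (addEdge G x y x≢y) v                                            ≡⟨ deg≡∑ (addEdge G x y x≢y) v ⟩
  ∑[ w < n ] 𝟙 (adj (addEdge G x y x≢y) v w)                           ≤⟨ sum-mono-≤ {n} (adj-addEdge G x y x≢y v) ⟩
  ∑[ w < n ] (𝟙 (adj G v w) + (δ v x * δ w y + δ v y * δ w x))         ≡⟨ ∑-distrib-+ {n} _ _ ⟩
  ∑[ w < n ] 𝟙 (adj G v w) + ∑[ w < n ] (δ v x * δ w y + δ v y * δ w x)
    ≡⟨ cong₂ _+_ (sym (deg≡∑ G v)) (∑-distrib-+ {n} _ _) ⟩
  deg G v + (∑[ w < n ] (δ v x * δ w y) + ∑[ w < n ] (δ v y * δ w x))
    ≡⟨ cong (deg G v +_) (cong₂ _+_ (sum-scaled-δ (δ v x) y) (sum-scaled-δ (δ v y) x)) ⟩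
  deg G v + (δ v x + δ v y)                                            ∎
  where open ≤-Reasoning

record IsEmbedding (H : Graph h) (G : Graph n) (f : Fin h → Fin n) : Set where
  constructor embedding
  field
    injective : Injective _≡_ _≡_ f
    edge      : ∀ u v → Edge H u v → Edge G (f u) (f v)

deg-embedding : {f : Fin h → Fin n} → IsEmbedding H G f → ∀ u → deg H u ≤ deg G (f u)
deg-embedding {h} {n} {H} {G} {f} (embedding f-inj f-edge) u = begin
  deg H u                          ≡⟨ deg≡∑ H u ⟩
  ∑[ w < h ] 𝟙 (adj H u w)         ≤⟨ sum-mono-≤ (λ w → 𝟙-mono (f-edge u w)) ⟩
  ∑[ w < h ] 𝟙 (adj G (f u) (f w)) ≤⟨ sum-∘-injective f f-inj (𝟙 ∘ adj G (f u)) ⟩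
  ∑[ z < n ] 𝟙 (adj G (f u) z)     ≡⟨ deg≡∑ G (f u) ⟨
  deg G (f u)                      ∎
  where open ≤-Reasoning

IsClique : ∀ {p} → Graph n → Pred (Fin n) p → Set p
IsClique G C = ∀ a b → C a → C b → a ≢ b → Edge G a b

clique-⊆ : ∀ {p q} {C : Pred (Fin n) p} {C′ : Pred (Fin n) q} → (∀ {v} → C v → C′ v) → IsClique G C′ → IsClique G C
clique-⊆ C⊆C′ clique a b Ca Cb = clique a b (C⊆C′ Ca) (C⊆C′ Cb)

module _ {p} {C : Pred (Fin n) p} (C? : Decidable C) where

  count-∅ : (∀ v → ¬ C v) → count C? ≡ 0
  count-∅ ∄C = trans (sum-cong-≗ (λ v → cong 𝟙 (dec-false (C? v) (∄C v)))) (sum-replicate-zero n)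

  count≤1 : (∀ a b → C a → C b → a ≡ b) → count C? ≤ 1
  count≤1 C-unique with Finₚ.any? C?
  ... | no ∄C        = ≤-trans (≤-reflexive (count-∅ (λ v Cv → ∄C (v , Cv)))) z≤n
  ... | yes (v , Cv) = ≤-trans (sum-mono-≤ C≤δ) (≤-reflexive (sum-δ v))
    where
    C≤δ : ∀ w → 𝟙 (does (C? w)) ≤ δ w v
    C≤δ w with C? w
    ... | no _   = z≤n
    ... | yes Cw = ≤-reflexive (sym (trans (cong (λ z → δ z v) (C-unique w v Cw Cv)) (δ-refl v)))

  clique-count≤ : (G : Graph n) → IsClique G C → ∀ {v} → C v → count C? ≤ suc (deg G v)
  clique-count≤ G clique {v} Cv = begin
    count C?                                    ≤⟨ sum-mono-≤ C≤δ+adj ⟩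
    ∑[ w < n ] (δ w v + 𝟙 (adj G v w))          ≡⟨ ∑-distrib-+ {n} _ _ ⟩
    ∑[ w < n ] δ w v + ∑[ w < n ] 𝟙 (adj G v w) ≡⟨ cong₂ _+_ (sum-δ v) (sym (deg≡∑ G v)) ⟩
    suc (deg G v)                               ∎
    where
    open ≤-Reasoning
    C≤δ+adj : ∀ w → 𝟙 (does (C? w)) ≤ δ w v + 𝟙 (adj G v w)
    C≤δ+adj w with C? w
    ... | no _   = z≤n
    ... | yes Cw with w ≟ v
    ...   | yes refl = s≤s z≤n
    ...   | no w≢v   = ≤-reflexive (cong 𝟙 (sym (clique v w Cv Cw (w≢v ∘ sym))))

  clique-count≤-bounded : (G : Graph n) → IsClique G C → ∀ {k} → (∀ v → C v → deg G v ≤ k) → count C? ≤ suc k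
  clique-count≤-bounded G clique deg≤k with Finₚ.any? C?
  ... | no ∄C        = ≤-trans (≤-reflexive (count-∅ (λ v Cv → ∄C (v , Cv)))) z≤n
  ... | yes (v , Cv) = ≤-trans (clique-count≤ G clique Cv) (s≤s (deg≤k v Cv))

amgm-≤ : ∀ {s t} → s ≤ t → 4 * (s * t) ≤ (s + t) ^ 2
amgm-≤ {s} s≤t with r , refl ← m≤n⇒∃[o]m+o≡n s≤t = begin
  4 * (s * (s + r))                   ≤⟨ m≤m+n _ (r * r) ⟩
  4 * (s * (s + r)) + r * r           ≡⟨ solve (s ∷ r ∷ []) ⟩
  (s + (s + r)) * ((s + (s + r)) * 1) ∎
  where open ≤-Reasoning

amgm : ∀ s t → 4 * (s * t) ≤ (s + t) ^ 2
amgm s t with ≤-total s t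
... | inj₁ s≤t = amgm-≤ s≤t
... | inj₂ t≤s = subst₂ _≤_ (cong (4 *_) (*-comm t s)) (cong (_^ 2) (+-comm t s)) (amgm-≤ t≤s)

amgm-∸ : ∀ s m → 4 * (s * (m ∸ s)) ≤ m ^ 2
amgm-∸ s m with ≤-total s m
... | inj₁ s≤m = subst (λ t → 4 * (s * (m ∸ s)) ≤ t ^ 2) (m+[n∸m]≡n s≤m) (amgm s (m ∸ s))
... | inj₂ m≤s rewrite m≤n⇒m∸n≡0 m≤s | *-zeroʳ s = z≤n

-- Each v of degree < k lies in the clique, so |clique| ≤ d(v) + 1 and k − d(v) ≤ k + 1 − |clique|.
deficit-bound : (G : Graph n) (k : ℕ) → IsClique G (λ v → deg G v < k) → 4 * ∑[ v < n ] (k ∸ deg G v) ≤ (k + 1) ^ 2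
deficit-bound {n} G k clique = begin
  4 * ∑[ v < n ] (k ∸ deg G v)                       ≤⟨ *-monoʳ-≤ 4 (sum-mono-≤ (λ v → deficit≤ v (small? v))) ⟩
  4 * ∑[ v < n ] (𝟙 (does (small? v)) * (k + 1 ∸ s)) ≡⟨ cong (4 *_) (*-distribʳ-sum (k + 1 ∸ s) (𝟙 ∘ does ∘ small?)) ⟨
  4 * (s * (k + 1 ∸ s))                              ≤⟨ amgm-∸ s (k + 1) ⟩
  (k + 1) ^ 2                                        ∎
  where
  open ≤-Reasoning
  small? : ∀ v → Dec (deg G v < k)
  small? v = deg G v <? k
  s = count small?
  deficit≤ : ∀ v (d<k? : Dec (deg G v < k)) → k ∸ deg G v ≤ 𝟙 (does d<k?) * (k + 1 ∸ s)
  deficit≤ v (yes d<k) = ≤-trans (∸-monoʳ-≤ (suc k) (clique-count≤ small? G clique d<k))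
                                 (≤-reflexive (trans (cong (_∸ s) (+-comm 1 k)) (sym (+-identityʳ _))))
  deficit≤ v (no d≮k)  = ≤-reflexive (m≤n⇒m∸n≡0 (≮⇒≥ d≮k))

-- Saturated graphs

edge-sym : (G : Graph n) {u v : Fin n} → Edge G u v → Edge G v u
edge-sym G {u} {v} uv = trans (Graph.sym G v u) uv

addEdge-cases : (G : Graph n) (x y : Fin n) (x≢y : x ≢ y) {a b : Fin n} →
  Edge (addEdge G x y x≢y) a b → Edge G a b ⊎ (a ≡ x × b ≡ y) ⊎ (a ≡ y × b ≡ x)
addEdge-cases G x y x≢y {a} {b} ab with adj G a b | a ≟ x | b ≟ y | a ≟ y | b ≟ x
... | true  | _       | _       | _       | _       = inj₁ refl
... | false | yes a≡x | yes b≡y | _       | _       = inj₂ (inj₁ (a≡x , b≡y))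
... | false | _       | _       | yes a≡y | yes b≡x = inj₂ (inj₂ (a≡y , b≡x))
... | false | no _    | _       | no _    | _       = contradiction ab λ ()
... | false | no _    | _       | yes _   | no _    = contradiction ab λ ()
... | false | yes _   | no _    | no _    | _       = contradiction ab λ ()
... | false | yes _   | no _    | yes _   | no _    = contradiction ab λ ()

-- What G learns from a copy of H in G + xy that maps the edge uv of H onto xy.
record CopyThrough (H : Graph h) (G : Graph n) (x y : Fin n) : Set where
  field
    {u v}  : Fin h
    edge   : Edge H u v
    deg-u≤ : deg H u ≤ suc (deg G x)
    deg-v≤ : deg H v ≤ suc (deg G y)
    image≥ : ∀ w → InN H u v w → ∃[ z ] ((Edge G x z ⊎ Edge G y z) × deg H w ≤ deg G z)

copyThrough : {x y : Fin n} (x≢y : x ≢ y) {f : Fin h → Fin n} → IsEmbedding H (addEdge G x y x≢y) f →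
  ∀ {u v} → Edge H u v → f u ≡ x → f v ≡ y → CopyThrough H G x y
copyThrough {H = H} {G = G} x≢y {f} f-emb@(embedding f-inj f-edge) {u} {v} uv refl refl = record
  { edge   = uv
  ; deg-u≤ = ≤-trans (deg-embedding f-emb u) (endpoint-deg (cong₂ _+_ (δ-refl (f u)) (δ-≢ x≢y)))
  ; deg-v≤ = ≤-trans (deg-embedding f-emb v) (endpoint-deg (cong₂ _+_ (δ-≢ (x≢y ∘ sym)) (δ-refl (f v))))
  ; image≥ = image≥
  }
  where
  G′ = addEdge G (f u) (f v) x≢y

  endpoint-deg : ∀ {z} → δ z (f u) + δ z (f v) ≡ 1 → deg G′ z ≤ suc (deg G z)
  endpoint-deg {z} δ-sum = ≤-trans (deg-addEdge G (f u) (f v) x≢y z)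
    (≤-reflexive (trans (cong (deg G z +_) δ-sum) (+-comm (deg G z) 1)))

  image≥ : ∀ w → InN H u v w → ∃[ z ] ((Edge G (f u) z ⊎ Edge G (f v) z) × deg H w ≤ deg G z)
  image≥ w (w≢u , w≢v , uw⊎vw) = f w , edge-to-image uw⊎vw , ≤-trans (deg-embedding f-emb w) image-deg
    where
    fw≢fu : f w ≢ f u
    fw≢fu = w≢u ∘ f-inj
    fw≢fv : f w ≢ f v
    fw≢fv = w≢v ∘ f-inj
    image-deg : deg G′ (f w) ≤ deg G (f w)
    image-deg = ≤-trans (deg-addEdge G (f u) (f v) x≢y (f w))
      (≤-reflexive (trans (cong₂ (λ a b → deg G (f w) + (a + b)) (δ-≢ fw≢fu) (δ-≢ fw≢fv)) (+-identityʳ _)))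
    edge-to-image : Edge H u w ⊎ Edge H v w → Edge G (f u) (f w) ⊎ Edge G (f v) (f w)
    edge-to-image (inj₁ uw) with addEdge-cases G (f u) (f v) x≢y (f-edge u w uw)
    ... | inj₁ e                = inj₁ e
    ... | inj₂ (inj₁ (_ , fw≡)) = contradiction fw≡ fw≢fv
    ... | inj₂ (inj₂ (fu≡ , _)) = contradiction fu≡ x≢y
    edge-to-image (inj₂ vw) with addEdge-cases G (f u) (f v) x≢y (f-edge v w vw)
    ... | inj₁ e                = inj₂ e
    ... | inj₂ (inj₁ (fv≡ , _)) = contradiction (sym fv≡) x≢y
    ... | inj₂ (inj₂ (_ , fw≡)) = contradiction fw≡ fw≢fu

preserves? : (H : Graph h) (G : Graph n) (f : Fin h → Fin n) (u v : Fin h) → Dec (Edge H u v → Edge G (f u) (f v))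
preserves? H G f u v = (adj H u v Bool.≟ true) →-dec (adj G (f u) (f v) Bool.≟ true)

embedding-uses-new-edge : {x y : Fin n} (x≢y : x ≢ y) → ¬ ContainsCopy G H →
  {f : Fin h → Fin n} → IsEmbedding H (addEdge G x y x≢y) f →
  ∃[ u ] ∃[ v ] (Edge H u v × f u ≡ x × f v ≡ y)
embedding-uses-new-edge {n} {G} {h} {H} x≢y no-copy {f} (embedding f-inj f-edge)
  with u , ¬∀preserved ← Finₚ.¬∀⟶∃¬ h _ (Finₚ.all? ∘ preserves? H G f) (λ ∀p → no-copy (f , f-inj , λ u v → ∀p u v))
  with v , ¬preserved ← Finₚ.¬∀⟶∃¬ h _ (preserves? H G f u) ¬∀preserved
  with adj H u v Bool.≟ true
... | no ¬uv = contradiction (λ uv → contradiction uv ¬uv) ¬preserved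
... | yes uv with addEdge-cases G _ _ x≢y (f-edge u v uv)
...   | inj₁ fufv               = contradiction (λ _ → fufv) ¬preserved
...   | inj₂ (inj₁ (fu≡ , fv≡)) = u , v , uv , fu≡ , fv≡
...   | inj₂ (inj₂ (fu≡ , fv≡)) = v , u , edge-sym H uv , fv≡ , fu≡

saturated⇒copyThrough : Saturated H G → {x y : Fin n} → x ≢ y → adj G x y ≡ false → CopyThrough H G x y
saturated⇒copyThrough {H = H} {G = G} (no-copy , saturated) x≢y xy with saturated _ _ x≢y xy
... | f , f-inj , f-edge
  with u , v , uv , fu≡x , fv≡y ← embedding-uses-new-edge {G = G} {H = H} x≢y no-copy (embedding f-inj f-edge) =
  copyThrough {G = G} x≢y (embedding f-inj f-edge) uv fu≡x fv≡y

wt₀≤⊔ : (H : Graph h) {u v : Fin h} {a b : ℕ} → deg H u ≤ suc a → deg H v ≤ suc b → wt₀ H u v ≤ a ⊔ b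
wt₀≤⊔ H du dv = ∸-monoˡ-≤ 1 (⊔-lub (≤-trans du (s≤s (m≤m⊔n _ _))) (≤-trans dv (s≤s (m≤n⊔m _ _))))

InN? : (H : Graph h) (u v : Fin h) → Decidable (InN H u v)
InN? H u v w = ¬? (w ≟ u) ×-dec ¬? (w ≟ v) ×-dec ((adj H u w Bool.≟ true) ⊎-dec (adj H v w Bool.≟ true))

wt₁-witness : (H : Graph h) {u v : Fin h} → Edge H u v → ¬IsolatedEdge H u v → ∃[ j ] Wt₁ H u v j
wt₁-witness {h} H {u} {v} uv ¬isolated with Finₚ.any? (InN? H u v)
... | no ∄w           = contradiction (uv , λ w w∈N → ∄w (w , w∈N)) ¬isolated
... | yes (w₀ , w₀∈N) = deg H w* , (w* , w*∈N , refl) , maximal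
  where
  ws = filter (InN? H u v) (allFin h)
  w* = argmax (deg H) w₀ ws
  w*∈N : InN H u v w*
  w*∈N = argmax-all (deg H) w₀∈N (all-filter (InN? H u v) (allFin h))
  maximal : ∀ w → InN H u v w → deg H w ≤ deg H w*
  maximal w w∈N = All.lookup (f[xs]≤f[argmax] w₀ ws) (∈-filter⁺ (InN? H u v) (∈-allFin w) w∈N)

copyThrough-large-neighbour : ∀ {k} {x y : Fin n} (c : CopyThrough H G x y) →
  let open CopyThrough c in
  ¬IsolatedEdge H u v → (∀ j → Wt₁ H u v j → k ≤ j) → ∃[ z ] ((Edge G x z ⊎ Edge G y z) × k ≤ deg G z)
copyThrough-large-neighbour {H = H} {G = G} c ¬isolated k≤wt₁
  with j , wt@((w , w∈N , dw≡j) , _) ← wt₁-witness H (CopyThrough.edge c) ¬isolated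
  with z , xz⊎yz , dw≤dz ← CopyThrough.image≥ c w w∈N =
  z , xz⊎yz , ≤-trans (k≤wt₁ j wt) (subst (_≤ deg G z) dw≡j dw≤dz)

LowNoHigh : (G : Graph n) (k₀ k₁' : ℕ) → Pred (Fin n) _
LowNoHigh G k₀ k₁' v = deg G v ≤ k₀ × (∀ z → Edge G v z → deg G z < k₁')

HighAllLow : (G : Graph n) (k₀ k₁' : ℕ) → Pred (Fin n) _
HighAllLow G k₀ k₁' v = k₁' ≤ deg G v × (∀ z → Edge G v z → deg G z ≤ k₀)

module _ {h n} {H : Graph h} {G : Graph n} (sat : Saturated H G) where

  saturated-clique : ∀ {p} {C : Pred (Fin n) p} → (∀ {a b} → C a → C b → ¬ CopyThrough H G a b) → IsClique G C
  saturated-clique no-copy a b Ca Cb a≢b with adj G a b in ab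
  ... | true  = refl
  ... | false = contradiction (saturated⇒copyThrough sat a≢b ab) (no-copy Ca Cb)

  small-vertices-clique : ∀ {k} → (∀ u v → Edge H u v → k ≤ wt₀ H u v) → IsClique G (λ v → deg G v < k)
  small-vertices-clique {k} k≤wt₀ = saturated-clique no-copy
    where
    no-copy : ∀ {a b} → deg G a < k → deg G b < k → ¬ CopyThrough H G a b
    no-copy da<k db<k c = <⇒≱ (≤-<-trans (wt₀≤⊔ H deg-u≤ deg-v≤) (⊔-lub da<k db<k)) (k≤wt₀ u v edge)
      where open CopyThrough c

  lowNoHigh-clique : ∀ {k₀ k₁'} → IsK₀ H k₀ → IsK₁' H k₀ k₁' → (∀ u v → ¬IsolatedEdge H u v) →
    IsClique G (LowNoHigh G k₀ k₁')
  lowNoHigh-clique {k₀} {k₁'} (_ , k₀≤wt₀) (_ , k₁'≤wt₁) no-isolated = saturated-clique no-copy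
    where
    no-copy : ∀ {a b} → LowNoHigh G k₀ k₁' a → LowNoHigh G k₀ k₁' b → ¬ CopyThrough H G a b
    no-copy (da≤k₀ , a-no-high) (db≤k₀ , b-no-high) c =
      (λ (z , az⊎bz , k₁'≤dz) → <⇒≱ ([ a-no-high z , b-no-high z ]′ az⊎bz) k₁'≤dz)
      (copyThrough-large-neighbour c (no-isolated u v) (λ j → k₁'≤wt₁ u v j edge wt₀≡k₀))
      where
      open CopyThrough c
      wt₀≡k₀ : wt₀ H u v ≡ k₀
      wt₀≡k₀ = ≤-antisym (≤-trans (wt₀≤⊔ H deg-u≤ deg-v≤) (⊔-lub da≤k₀ db≤k₀)) (k₀≤wt₀ u v edge)

  -- Two such vertices cannot be adjacent (the neighbour would have degree ≤ k₀ < k₁'), nor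
  -- non-adjacent (the copy through them would need a neighbour of degree ≥ k₁ > k₀).
  highAllLow-unique : ∀ {k₀ k₁ k₁'} → IsK₁ H k₁ → (∀ u v → ¬IsolatedEdge H u v) → k₀ < k₁' → k₀ < k₁ →
    ∀ a b → HighAllLow G k₀ k₁' a → HighAllLow G k₀ k₁' b → a ≡ b
  highAllLow-unique {k₀} {k₁} {k₁'} (_ , k₁≤wt₁) no-isolated k₀<k₁' k₀<k₁ a b Ia@(_ , a-all-low) Ib@(k₁'≤db , _)
    with a ≟ b
  ... | yes a≡b = a≡b
  ... | no a≢b  = contradiction (≤-trans k₁'≤db (a-all-low b (saturated-clique no-copy a b Ia Ib a≢b))) (<⇒≱ k₀<k₁')
    where
    no-copy : ∀ {a b} → HighAllLow G k₀ k₁' a → HighAllLow G k₀ k₁' b → ¬ CopyThrough H G a b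
    no-copy (_ , a-all-low) (_ , b-all-low) c =
      (λ (z , az⊎bz , k₁≤dz) → <⇒≱ (≤-<-trans ([ a-all-low z , b-all-low z ]′ az⊎bz) k₀<k₁) k₁≤dz)
      (copyThrough-large-neighbour c (no-isolated u v) (λ j → k₁≤wt₁ u v j edge))
      where open CopyThrough c

-- Discharging

nbrCount : (G : Graph n) → (Fin n → Bool) → Fin n → ℕ
nbrCount {n} G Q v = ∑[ w < n ] (𝟙 (adj G v w) * 𝟙 (Q w))

double-count : (G : Graph n) (P Q : Fin n → Bool) →
  ∑[ v < n ] (if P v then nbrCount G Q v else 0) ≡ ∑[ v < n ] (if Q v then nbrCount G P v else 0)
double-count {n} G P Q = begin
  ∑[ v < n ] (if P v then nbrCount G Q v else 0)              ≡⟨ sum-cong-≗ (as-double-sum P Q) ⟩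
  ∑[ v < n ] ∑[ w < n ] (𝟙 (P v) * (𝟙 (adj G v w) * 𝟙 (Q w))) ≡⟨ sum-cong-≗ (λ v → sum-cong-≗ (edge-term v)) ⟩
  ∑[ v < n ] ∑[ w < n ] (𝟙 (Q w) * (𝟙 (adj G w v) * 𝟙 (P v))) ≡⟨ ∑-comm (λ v w → 𝟙 (Q w) * (𝟙 (adj G w v) * 𝟙 (P v))) ⟩
  ∑[ w < n ] ∑[ v < n ] (𝟙 (Q w) * (𝟙 (adj G w v) * 𝟙 (P v))) ≡⟨ sum-cong-≗ (as-double-sum Q P) ⟨
  ∑[ w < n ] (if Q w then nbrCount G P w else 0)              ∎
  where
  open ≡-Reasoning
  as-double-sum : ∀ P Q v → (if P v then nbrCount G Q v else 0) ≡ ∑[ w < n ] (𝟙 (P v) * (𝟙 (adj G v w) * 𝟙 (Q w)))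
  as-double-sum P Q v = trans (if≡𝟙* (P v) (nbrCount G Q v)) (*-distribˡ-sum (𝟙 (P v)) (λ w → 𝟙 (adj G v w) * 𝟙 (Q w)))
  reorder : ∀ a b c → a * (b * c) ≡ c * (b * a)
  reorder = solve-∀
  edge-term : ∀ v w → 𝟙 (P v) * (𝟙 (adj G v w) * 𝟙 (Q w)) ≡ 𝟙 (Q w) * (𝟙 (adj G w v) * 𝟙 (P v))
  edge-term v w = trans (reorder (𝟙 (P v)) (𝟙 (adj G v w)) (𝟙 (Q w)))
                        (cong (λ b → 𝟙 (Q w) * (𝟙 b * 𝟙 (P v))) (Graph.sym G v w))

discharge : (G : Graph n) {T K : ℕ} (sent received D : Fin n → ℕ) →
  ∑[ v < n ] sent v ≡ ∑[ v < n ] received v →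
  (∀ v → sent v + T ≤ received v + K * deg G v + D v) →
  n * T ≤ K * (2 * numEdges G) + ∑[ v < n ] D v
discharge {n} G {T} {K} sent received D Σsent≡Σreceived charge = +-cancelˡ-≤ (sum sent) _ _ (begin
  sum sent + n * T                                ≡⟨ cong (sum sent +_) (sum-const {n} T) ⟨
  sum sent + ∑[ v < n ] T                         ≡⟨ ∑-distrib-+ sent (const T) ⟨
  ∑[ v < n ] (sent v + T)                         ≤⟨ sum-mono-≤ charge ⟩
  ∑[ v < n ] (received v + K * deg G v + D v)     ≡⟨ ∑-distrib-+ {n} _ D ⟩
  ∑[ v < n ] (received v + K * deg G v) + sum D   ≡⟨ cong (_+ sum D) (∑-distrib-+ received _) ⟩
  sum received + ∑[ v < n ] (K * deg G v) + sum D ≡⟨ cong (λ t → sum received + t + sum D) (*-distribˡ-sum K (deg G)) ⟨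
  sum received + K * ∑[ v < n ] deg G v + sum D
    ≡⟨ cong₂ (λ s t → s + K * t + sum D) (sym Σsent≡Σreceived) (handshake G) ⟩
  sum sent + K * (2 * numEdges G) + sum D         ≡⟨ +-assoc (sum sent) _ _ ⟩
  sum sent + (K * (2 * numEdges G) + sum D)       ∎)
  where open ≤-Reasoning

deficit-split : ∀ K {k₀ d} → d ≤ k₀ → K * d + K * (k₀ ∸ d) ≡ k₀ * K
deficit-split K {k₀} d≤k₀ = trans (sym (*-distribˡ-+ K _ _)) (trans (cong (K *_) (m+[n∸m]≡n d≤k₀)) (*-comm K k₀))

low-charge : ∀ {k₀ K A d h} → d ≤ k₀ → (h≡0? : Dec (h ≡ 0)) →
  k₀ * K + A ≤ h * A + K * d + ((if does h≡0? then A else 0) + K * (k₀ ∸ d))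
low-charge {k₀} {K} {A} {d} d≤k₀ (yes refl) = ≤-reflexive (begin
  k₀ * K + A                 ≡⟨ cong (_+ A) (deficit-split K d≤k₀) ⟨
  K * d + K * (k₀ ∸ d) + A   ≡⟨ +-assoc (K * d) _ A ⟩
  K * d + (K * (k₀ ∸ d) + A) ≡⟨ cong (K * d +_) (+-comm _ A) ⟩
  K * d + (A + K * (k₀ ∸ d)) ∎)
  where open ≡-Reasoning
low-charge {k₀} {K} {A} {d} {h} d≤k₀ (no h≢0) = begin
  k₀ * K + A                   ≡⟨ cong (_+ A) (deficit-split K d≤k₀) ⟨
  K * d + K * (k₀ ∸ d) + A     ≤⟨ +-monoʳ-≤ _ (m≤n*m A h {{ℕ.≢-nonZero h≢0}}) ⟩
  K * d + K * (k₀ ∸ d) + h * A ≡⟨ rotate (K * d) _ _ ⟩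
  h * A + K * d + K * (k₀ ∸ d) ∎
  where
  open ≤-Reasoning
  rotate : ∀ a b c → a + b + c ≡ c + a + b
  rotate = solve-∀

mid-charge : ∀ {k₀ K A d} → k₀ < d → A ≤ K → k₀ * K + A ≤ K * d
mid-charge {k₀} {K} {A} {d} k₀<d A≤K = begin
  k₀ * K + A ≤⟨ +-monoʳ-≤ (k₀ * K) A≤K ⟩
  k₀ * K + K ≡⟨ +-comm (k₀ * K) K ⟩
  suc k₀ * K ≤⟨ *-monoˡ-≤ K k₀<d ⟩
  d * K      ≡⟨ *-comm d K ⟩
  K * d      ∎
  where open ≤-Reasoning

high-charge₁ : ∀ {k₀ A d l} → k₀ + A ≤ d → l ≤ d → l * A + (k₀ * (k₀ + A + 1) + A) ≤ (k₀ + A + 1) * d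
high-charge₁ {k₀} {A} {d} {l} k'≤d l≤d = begin
  l * A + (k₀ * (k₀ + A + 1) + A) ≡⟨ solve (k₀ ∷ A ∷ l ∷ []) ⟩
  (k₀ + 1) * (k₀ + A) + l * A     ≤⟨ +-mono-≤ (*-monoʳ-≤ (k₀ + 1) k'≤d) (*-monoˡ-≤ A l≤d) ⟩
  (k₀ + 1) * d + d * A            ≡⟨ solve (k₀ ∷ A ∷ d ∷ []) ⟩
  (k₀ + A + 1) * d                ∎
  where open ≤-Reasoning

high-charge₂ : ∀ {k₀ A d l} → k₀ + A ≤ d → l ≤ d → (l≡d? : Dec (l ≡ d)) →
  l * A + (k₀ * (k₀ + A) + A) ≤ (k₀ + A) * d + (if does l≡d? then A else 0)
high-charge₂ {k₀} {A} {d} k'≤d _ (yes refl) = begin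
  d * A + (k₀ * (k₀ + A) + A) ≡⟨ solve (k₀ ∷ A ∷ d ∷ []) ⟩
  k₀ * (k₀ + A) + d * A + A   ≤⟨ +-monoˡ-≤ A (+-monoˡ-≤ (d * A) (*-monoʳ-≤ k₀ k'≤d)) ⟩
  k₀ * d + d * A + A          ≡⟨ solve (k₀ ∷ A ∷ d ∷ []) ⟩
  (k₀ + A) * d + A            ∎
  where open ≤-Reasoning
high-charge₂ {k₀} {A} {d} {l} k'≤d l≤d (no l≢d) = begin
  l * A + (k₀ * (k₀ + A) + A) ≡⟨ solve (k₀ ∷ A ∷ l ∷ []) ⟩
  k₀ * (k₀ + A) + suc l * A   ≤⟨ +-mono-≤ (*-monoʳ-≤ k₀ k'≤d) (*-monoˡ-≤ A (≤∧≢⇒< l≤d l≢d)) ⟩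
  k₀ * d + d * A              ≡⟨ solve (k₀ ∷ A ∷ d ∷ []) ⟩
  (k₀ + A) * d + 0            ∎
  where open ≤-Reasoning

-- The charge inequality at a vertex of degree d with l low and h high neighbours.  Transfers and
-- bonuses are written as `if … then … else 0`, so that each case of the decisions reduces them.
vertex-charge₁ : ∀ {k₀ k' A d l h} → k₀ < k' → k₀ + A ≡ k' → l ≤ d →
  (low? : Dec (d ≤ k₀)) (high? : Dec (k' ≤ d)) (h≡0? : Dec (h ≡ 0)) →
  (if does high? then l else 0) * A + (k₀ * (k' + 1) + A)
    ≤ (if does low? then h else 0) * A + (k' + 1) * d
      + ((if does (low? ×-dec h≡0?) then A else 0) + (k' + 1) * (k₀ ∸ d))
vertex-charge₁ k₀<k' _ _ (yes d≤k₀) (yes k'≤d) _ = contradiction (≤-trans k'≤d d≤k₀) (<⇒≱ k₀<k')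
vertex-charge₁ _ _ _ (yes d≤k₀) (no _) h≡0? = low-charge d≤k₀ h≡0?
vertex-charge₁ {k₀} {A = A} _ refl _ (no d≰k₀) (no _) _ =
  ≤-trans (mid-charge (≰⇒> d≰k₀) (≤-trans (m≤n+m A k₀) (m≤m+n _ 1))) (m≤m+n _ _)
vertex-charge₁ _ refl l≤d (no _) (yes k'≤d) _ = ≤-trans (high-charge₁ k'≤d l≤d) (m≤m+n _ _)

vertex-charge₂ : ∀ {k₀ k' A d l h} → k₀ < k' → k₀ + A ≡ k' → l ≤ d →
  (low? : Dec (d ≤ k₀)) (high? : Dec (k' ≤ d)) (h≡0? : Dec (h ≡ 0)) →
  (if does high? then l else 0) * A + (k₀ * k' + A)
    ≤ (if does low? then h else 0) * A + k' * d
      + ((if does (high? ×-dec (l ℕ.≟ d)) then A else 0)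
        + ((if does (low? ×-dec h≡0?) then A else 0) + k' * (k₀ ∸ d)))
vertex-charge₂ k₀<k' _ _ (yes d≤k₀) (yes k'≤d) _ = contradiction (≤-trans k'≤d d≤k₀) (<⇒≱ k₀<k')
vertex-charge₂ _ _ _ (yes d≤k₀) (no _) h≡0? = low-charge d≤k₀ h≡0?
vertex-charge₂ {k₀} {A = A} _ refl _ (no d≰k₀) (no _) _ = ≤-trans (mid-charge (≰⇒> d≰k₀) (m≤n+m A k₀)) (m≤m+n _ _)
vertex-charge₂ {k₀} {A = A} {d} {l} _ refl l≤d (no _) (yes k'≤d) _ =
  ≤-trans (high-charge₂ k'≤d l≤d (l ℕ.≟ d)) (+-monoʳ-≤ ((k₀ + A) * d) (m≤m+n _ _))

scale-bound : ∀ {n T K e B σ X s} → n * T ≤ K * (2 * e) + (B + K * σ) → B ≤ X → 4 * σ ≤ s →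
  4 * T * n ≤ 8 * K * e + 4 * X + K * s
scale-bound {n} {T} {K} {e} {B} {σ} {X} {s} nT≤ B≤X 4σ≤s = begin
  4 * T * n                       ≡⟨ solve (n ∷ T ∷ []) ⟩
  4 * (n * T)                     ≤⟨ *-monoʳ-≤ 4 nT≤ ⟩
  4 * (K * (2 * e) + (B + K * σ)) ≡⟨ solve (K ∷ e ∷ B ∷ σ ∷ []) ⟩
  8 * K * e + 4 * B + K * (4 * σ) ≤⟨ +-mono-≤ (+-monoʳ-≤ (8 * K * e) (*-monoʳ-≤ 4 B≤X)) (*-monoʳ-≤ K 4σ≤s) ⟩
  8 * K * e + 4 * X + K * s       ∎
  where open ≤-Reasoning

two-bonuses≤ : ∀ {a b c A} → a ≤ 1 → b ≤ c + 1 → a * A + b * A ≤ (c + 2) * A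
two-bonuses≤ {a} {b} {c} {A} a≤1 b≤c+1 = begin
  a * A + b * A       ≤⟨ +-mono-≤ (*-monoˡ-≤ A a≤1) (*-monoˡ-≤ A b≤c+1) ⟩
  1 * A + (c + 1) * A ≡⟨ solve (c ∷ A ∷ []) ⟩
  (c + 2) * A         ∎
  where open ≤-Reasoning

module Discharging {h n} {H : Graph h} {G : Graph n} (sat : Saturated H G) {k₀ k₁' : ℕ}
  (K₀ : IsK₀ H k₀) (K₁' : IsK₁' H k₀ k₁') (no-isolated : ∀ u v → ¬IsolatedEdge H u v) (k₀<k₁' : k₀ < k₁')
  where

  A : ℕ
  A = k₁' ∸ k₀

  k₀+A≡k₁' : k₀ + A ≡ k₁'
  k₀+A≡k₁' = m+[n∸m]≡n (<⇒≤ k₀<k₁')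

  low? : ∀ v → Dec (deg G v ≤ k₀)
  low? v = deg G v ≤? k₀

  high? : ∀ v → Dec (k₁' ≤ deg G v)
  high? v = k₁' ≤? deg G v

  highNbrs lowNbrs : Fin n → ℕ
  highNbrs = nbrCount G (does ∘ high?)
  lowNbrs  = nbrCount G (does ∘ low?)

  lowNoHigh? : ∀ v → Dec (deg G v ≤ k₀ × highNbrs v ≡ 0)
  lowNoHigh? v = low? v ×-dec (highNbrs v ℕ.≟ 0)

  highAllLow? : ∀ v → Dec (k₁' ≤ deg G v × lowNbrs v ≡ deg G v)
  highAllLow? v = high? v ×-dec (lowNbrs v ℕ.≟ deg G v)

  sent received : Fin n → ℕ
  sent v     = (if does (high? v) then lowNbrs v else 0) * A
  received v = (if does (low? v) then highNbrs v else 0) * A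

  sent≡received : ∑[ v < n ] sent v ≡ ∑[ v < n ] received v
  sent≡received = begin
    ∑[ v < n ] sent v
      ≡⟨ *-distribʳ-sum A (λ v → if does (high? v) then lowNbrs v else 0) ⟨
    ∑[ v < n ] (if does (high? v) then lowNbrs v else 0) * A
      ≡⟨ cong (_* A) (double-count G (does ∘ high?) (does ∘ low?)) ⟩
    ∑[ v < n ] (if does (low? v) then highNbrs v else 0) * A
      ≡⟨ *-distribʳ-sum A (λ v → if does (low? v) then highNbrs v else 0) ⟩
    ∑[ v < n ] received v
      ∎
    where open ≡-Reasoning

  lowNbrs≤deg : ∀ v → lowNbrs v ≤ deg G v
  lowNbrs≤deg v = ≤-trans (sum-mono-≤ (λ w → 𝟙*𝟙≤𝟙 (adj G v w) (does (low? w)))) (≤-reflexive (sym (deg≡∑ G v)))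

  lowNoHigh-sound : ∀ {v} → deg G v ≤ k₀ × highNbrs v ≡ 0 → LowNoHigh G k₀ k₁' v
  lowNoHigh-sound {v} (dv≤k₀ , no-high) = dv≤k₀ , λ z vz → ≰⇒> λ k₁'≤dz → contradiction
    (subst (1 ≤_) no-high (subst (_≤ highNbrs v) (cong₂ (λ a b → 𝟙 a * 𝟙 b) vz (dec-true (high? z) k₁'≤dz))
      (term≤sum (λ w → 𝟙 (adj G v w) * 𝟙 (does (high? w))) z)))
    λ ()

  highAllLow-sound : ∀ {v} → k₁' ≤ deg G v × lowNbrs v ≡ deg G v → HighAllLow G k₀ k₁' v
  highAllLow-sound {v} (k₁'≤dv , all-low) = k₁'≤dv , λ z vz → 𝟙-does≡1 (low? z)
    (trans (sym (*-identityˡ _)) (subst (λ b → 𝟙 b * 𝟙 (does (low? z)) ≡ 𝟙 b) vz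
      (sum-≡⇒≗ (λ w → 𝟙*𝟙≤𝟙 (adj G v w) (does (low? w))) (trans all-low (deg≡∑ G v)) z)))

  lowNoHigh-count : count lowNoHigh? ≤ k₀ + 1
  lowNoHigh-count = ≤-trans (clique-count≤-bounded lowNoHigh? G clique (λ _ → proj₁)) (≤-reflexive (+-comm 1 k₀))
    where
    clique : IsClique G (λ v → deg G v ≤ k₀ × highNbrs v ≡ 0)
    clique = clique-⊆ {G = G} lowNoHigh-sound (lowNoHigh-clique {H = H} {G = G} sat K₀ K₁' no-isolated)

  highAllLow-count : ∀ {k₁} → IsK₁ H k₁ → k₀ < k₁ → count highAllLow? ≤ 1
  highAllLow-count {k₁} K₁ k₀<k₁ = count≤1 highAllLow? λ a b Ia Ib →
    highAllLow-unique {H = H} {G = G} sat {k₀} {k₁} {k₁'} K₁ no-isolated k₀<k₁' k₀<k₁ a b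
      (highAllLow-sound Ia) (highAllLow-sound Ib)

  deficit : ℕ
  deficit = ∑[ v < n ] (k₀ ∸ deg G v)

  4deficit≤ : 4 * deficit ≤ (k₀ + 1) ^ 2
  4deficit≤ = deficit-bound G k₀ (small-vertices-clique {H = H} {G = G} sat {k₀} (proj₂ K₀))

  sum-bonus+deficit : (B : Fin n → ℕ) (K : ℕ) → ∑[ v < n ] (B v + K * (k₀ ∸ deg G v)) ≡ sum B + K * deficit
  sum-bonus+deficit B K = trans (∑-distrib-+ B _) (cong (sum B +_) (sym (*-distribˡ-sum K (λ v → k₀ ∸ deg G v))))

  edge-bound₁ :
    4 * (k₀ * (k₁' + 1) + A) * n ≤ 8 * (k₁' + 1) * numEdges G + 4 * ((k₀ + 1) * A) + (k₁' + 1) * (k₀ + 1) ^ 2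
  edge-bound₁ = scale-bound {n} {k₀ * (k₁' + 1) + A} {k₁' + 1} {numEdges G} {count lowNoHigh? * A} {deficit}
    (≤-trans (discharge G {K = k₁' + 1} sent received D sent≡received charge)
             (≤-reflexive (cong ((k₁' + 1) * (2 * numEdges G) +_) ΣD)))
    (*-monoˡ-≤ A lowNoHigh-count) 4deficit≤
    where
    D : Fin n → ℕ
    D v = (if does (lowNoHigh? v) then A else 0) + (k₁' + 1) * (k₀ ∸ deg G v)
    charge : ∀ v → sent v + (k₀ * (k₁' + 1) + A) ≤ received v + (k₁' + 1) * deg G v + D v
    charge v = vertex-charge₁ k₀<k₁' k₀+A≡k₁' (lowNbrs≤deg v) (low? v) (high? v) (highNbrs v ℕ.≟ 0)
    ΣD : sum D ≡ count lowNoHigh? * A + (k₁' + 1) * deficit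
    ΣD = trans (sum-bonus+deficit (λ v → if does (lowNoHigh? v) then A else 0) (k₁' + 1))
               (cong (_+ (k₁' + 1) * deficit) (sum-if lowNoHigh? A))

  edge-bound₂ : ∀ {k₁} → IsK₁ H k₁ → k₀ < k₁ →
    4 * (k₀ * k₁' + A) * n ≤ 8 * k₁' * numEdges G + 4 * ((k₀ + 2) * A) + k₁' * (k₀ + 1) ^ 2
  edge-bound₂ K₁ k₀<k₁ =
    scale-bound {n} {k₀ * k₁' + A} {k₁'} {numEdges G} {count highAllLow? * A + count lowNoHigh? * A} {deficit}
      (≤-trans (discharge G {K = k₁'} sent received D sent≡received charge)
               (≤-reflexive (cong (k₁' * (2 * numEdges G) +_) ΣD)))
      (two-bonuses≤ (highAllLow-count K₁ k₀<k₁) lowNoHigh-count) 4deficit≤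
    where
    D : Fin n → ℕ
    D v = (if does (highAllLow? v) then A else 0) + ((if does (lowNoHigh? v) then A else 0) + k₁' * (k₀ ∸ deg G v))
    charge : ∀ v → sent v + (k₀ * k₁' + A) ≤ received v + k₁' * deg G v + D v
    charge v = vertex-charge₂ k₀<k₁' k₀+A≡k₁' (lowNbrs≤deg v) (low? v) (high? v) (highNbrs v ℕ.≟ 0)
    ΣD : sum D ≡ count highAllLow? * A + count lowNoHigh? * A + k₁' * deficit
    ΣD = begin
      sum D
        ≡⟨ ∑-distrib-+ (λ v → if does (highAllLow? v) then A else 0) _ ⟩
      ∑[ v < n ] (if does (highAllLow? v) then A else 0)
        + ∑[ v < n ] ((if does (lowNoHigh? v) then A else 0) + k₁' * (k₀ ∸ deg G v))
        ≡⟨ cong₂ _+_ (sum-if highAllLow? A) (trans (sum-bonus+deficit (λ v → if does (lowNoHigh? v) then A else 0) k₁')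
                                                   (cong (_+ k₁' * deficit) (sum-if lowNoHigh? A))) ⟩
      count highAllLow? * A + (count lowNoHigh? * A + k₁' * deficit)
        ≡⟨ +-assoc (count highAllLow? * A) _ _ ⟨
      count highAllLow? * A + count lowNoHigh? * A + k₁' * deficit
        ∎
      where open ≡-Reasoning

-- From the count to the rational bound

-- ℤ's +_ is opened only here; elsewhere it would make sections such as (a +_) ambiguous.
module _ where
  open import Data.Integer using (+_)

  toℚᵘ-÷ℕ : ∀ x d → toℚᵘ (x ÷ℕ suc d) ≃ᵘ + x /ᵘ suc d
  toℚᵘ-÷ℕ x d = toℚᵘ-fromℚᵘ (mkℚᵘ (+ x) d)

  ⊖≤+ : ∀ {p m r} → p ≤ r + m → p ⊖ m ℤ.≤ + r
  ⊖≤+ {p} {m} {r} p≤r+m =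
    ℤ.≤-trans (ℤ.⊖-monoˡ-≤ m p≤r+m) (ℤ.≤-reflexive (trans (ℤ.⊖-≥ (m≤n+m m r)) (cong +_ (m+n∸n≡m r m))))

  -- Cross-multiplied, the claim is the hypothesis multiplied by 4K.
  ℚᵘ-bound : ∀ k₀ A X s n e a → 4 * (k₀ * suc a + A) * n ≤ 8 * suc a * e + 4 * X + suc a * s →
    (+ k₀ /ᵘ 1 +ᵘ + A /ᵘ suc a) *ᵘ (+ n /ᵘ 2) -ᵘ (+ X /ᵘ (2 * suc a) +ᵘ + s /ᵘ 8) ≤ᵘ + e /ᵘ 1
  ℚᵘ-bound k₀ A X s n e a hyp = *≤* (begin
    ↥ L ℤ.* + 1 ≡⟨ ℤ.*-identityʳ (↥ L) ⟩
    ↥ L         ≡⟨ ↥L≡P-M ⟩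
    + P ℤ.- + M ≡⟨ ℤ.m-n≡m⊖n P M ⟩
    P ⊖ M       ≤⟨ ⊖≤+ P≤eD+M ⟩
    + (e * D)   ≡⟨ ℤ.pos-* e D ⟩
    + e ℤ.* + D ∎)
    where
    open ℤ.≤-Reasoning
    K = suc a
    L = (+ k₀ /ᵘ 1 +ᵘ + A /ᵘ K) *ᵘ (+ n /ᵘ 2) -ᵘ (+ X /ᵘ (2 * K) +ᵘ + s /ᵘ 8)
    P = (k₀ * K + A * 1) * n * (2 * K * 8)
    M = (X * 8 + s * (2 * K)) * (1 * K * 2)
    D = 1 * K * 2 * (2 * K * 8)

    P≤eD+M : P ≤ e * D + M
    P≤eD+M = subst₂ _≤_ (sym (scaled-P k₀ A n a)) (sym (scaled-eD+M e X s a)) (*-monoʳ-≤ (4 * K) hyp)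
      where
      scaled-P : ∀ k₀ A n a → (k₀ * suc a + A * 1) * n * (2 * suc a * 8) ≡ 4 * suc a * (4 * (k₀ * suc a + A) * n)
      scaled-P = solve-∀
      scaled-eD+M : ∀ e X s a → e * (1 * suc a * 2 * (2 * suc a * 8)) + (X * 8 + s * (2 * suc a)) * (1 * suc a * 2)
                                ≡ 4 * suc a * (8 * suc a * e + 4 * X + suc a * s)
      scaled-eD+M = solve-∀

    ↥L≡P-M : ↥ L ≡ + P ℤ.- + M
    ↥L≡P-M = cong₂ ℤ._+_ (sym cast-P)
      (trans (sym (ℤ.neg-distribˡ-* (+ X ℤ.* + 8 ℤ.+ + s ℤ.* + (2 * K)) (+ (1 * K * 2)))) (cong ℤ.-_ (sym cast-M)))
      where
      cast-slope : + (k₀ * K + A * 1) ≡ + k₀ ℤ.* + K ℤ.+ + A ℤ.* + 1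
      cast-slope = trans (ℤ.pos-+ (k₀ * K) (A * 1)) (cong₂ ℤ._+_ (ℤ.pos-* k₀ K) (ℤ.pos-* A 1))
      cast-P : + P ≡ ((+ k₀ ℤ.* + K ℤ.+ + A ℤ.* + 1) ℤ.* + n) ℤ.* + (2 * K * 8)
      cast-P = trans (ℤ.pos-* ((k₀ * K + A * 1) * n) (2 * K * 8))
        (cong (ℤ._* + (2 * K * 8)) (trans (ℤ.pos-* (k₀ * K + A * 1) n) (cong (ℤ._* + n) cast-slope)))
      cast-M : + M ≡ (+ X ℤ.* + 8 ℤ.+ + s ℤ.* + (2 * K)) ℤ.* + (1 * K * 2)
      cast-M = trans (ℤ.pos-* (X * 8 + s * (2 * K)) (1 * K * 2))
        (cong (ℤ._* + (1 * K * 2))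
          (trans (ℤ.pos-+ (X * 8) (s * (2 * K))) (cong₂ ℤ._+_ (ℤ.pos-* X 8) (ℤ.pos-* s (2 * K)))))

  ℚ-bound : ∀ k₀ A X s n e {K D} a → K ≡ suc a → D ≡ 2 * K →
    4 * (k₀ * K + A) * n ≤ 8 * K * e + 4 * X + K * s →
    (ℕ→ℚ k₀ +ℚ (A ÷ℕ K)) *ℚ (n ÷ℕ 2) -ℚ ((X ÷ℕ D) +ℚ (s ÷ℕ 8)) ≤ℚ ℕ→ℚ e
  ℚ-bound k₀ A X s n e a refl refl hyp =
    toℚᵘ-cancel-≤ (ℚᵘ.≤-respʳ-≃ (ℚᵘ.≃-sym (toℚᵘ-÷ℕ e 0))
                    (ℚᵘ.≤-respˡ-≃ (ℚᵘ.≃-sym toℚᵘ-lhs) (ℚᵘ-bound k₀ A X s n e a hyp)))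
    where
    slope  = ℕ→ℚ k₀ +ℚ (A ÷ℕ suc a)
    offset = (X ÷ℕ (2 * suc a)) +ℚ (s ÷ℕ 8)
    toℚᵘ-slope : toℚᵘ slope ≃ᵘ + k₀ /ᵘ 1 +ᵘ + A /ᵘ suc a
    toℚᵘ-slope = ℚᵘ.≃-trans (toℚᵘ-homo-+ (ℕ→ℚ k₀) (A ÷ℕ suc a)) (ℚᵘ.+-cong (toℚᵘ-÷ℕ k₀ 0) (toℚᵘ-÷ℕ A a))
    toℚᵘ-offset : toℚᵘ offset ≃ᵘ + X /ᵘ (2 * suc a) +ᵘ + s /ᵘ 8
    toℚᵘ-offset = ℚᵘ.≃-trans (toℚᵘ-homo-+ (X ÷ℕ (2 * suc a)) (s ÷ℕ 8)) (ℚᵘ.+-cong (toℚᵘ-÷ℕ X _) (toℚᵘ-÷ℕ s 7))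
    toℚᵘ-lhs : toℚᵘ (slope *ℚ (n ÷ℕ 2) -ℚ offset)
                 ≃ᵘ (+ k₀ /ᵘ 1 +ᵘ + A /ᵘ suc a) *ᵘ (+ n /ᵘ 2) -ᵘ (+ X /ᵘ (2 * suc a) +ᵘ + s /ᵘ 8)
    toℚᵘ-lhs = ℚᵘ.≃-trans (toℚᵘ-homo-+ (slope *ℚ (n ÷ℕ 2)) (Data.Rational.- offset))
      (ℚᵘ.+-cong (ℚᵘ.≃-trans (toℚᵘ-homo-* slope (n ÷ℕ 2)) (ℚᵘ.*-cong toℚᵘ-slope (toℚᵘ-÷ℕ n 1)))
                 (ℚᵘ.≃-trans (toℚᵘ-homo‿- offset) (ℚᵘ.-‿cong toℚᵘ-offset)))

<⇒≡suc-pred : ∀ {m n} → m < n → n ≡ suc (ℕ.pred n)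
<⇒≡suc-pred (s≤s _) = refl

lemma2p5 : ∀ {h} (H : Graph h) (k₀ k₁ k₁' : ℕ) →
    (∃[ u ] ∃[ v ] Edge H u v) →
    (∀ u v → ¬IsolatedEdge H u v) →
    IsK₀ H k₀ → IsK₁ H k₁ → IsK₁' H k₀ k₁' →
    k₀ < k₁' →
    ∀ n → h ≤ n → (G : Graph n) → Saturated H G →
      ((ℕ→ℚ k₀ +ℚ ((k₁' ∸ k₀) ÷ℕ (k₁' + 1))) *ℚ (n ÷ℕ 2)
          -ℚ (((k₀ + 1) * (k₁' ∸ k₀)) ÷ℕ (2 * k₁' + 2) +ℚ ((k₀ + 1) ^ 2) ÷ℕ 8)
        ≤ℚ ℕ→ℚ (numEdges G))
      ×
      (k₀ < k₁ →
        (ℕ→ℚ k₀ +ℚ ((k₁' ∸ k₀) ÷ℕ k₁')) *ℚ (n ÷ℕ 2)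
          -ℚ (((k₀ + 2) * (k₁' ∸ k₀)) ÷ℕ (2 * k₁') +ℚ ((k₀ + 1) ^ 2) ÷ℕ 8)
        ≤ℚ ℕ→ℚ (numEdges G))
lemma2p5 H k₀ k₁ k₁' _ no-isolated K₀ K₁ K₁' k₀<k₁' n _ G sat =
    ℚ-bound k₀ A ((k₀ + 1) * A) ((k₀ + 1) ^ 2) n (numEdges G)
      k₁' (+-comm k₁' 1) (sym (*-distribˡ-+ 2 k₁' 1)) edge-bound₁
  , λ k₀<k₁ → ℚ-bound k₀ A ((k₀ + 2) * A) ((k₀ + 1) ^ 2) n (numEdges G)
      (ℕ.pred k₁') (<⇒≡suc-pred k₀<k₁') refl (edge-bound₂ K₁ k₀<k₁)
  where open Discharging {H = H} {G = G} sat K₀ K₁' no-isolated k₀<k₁'
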